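{- Let $T$ be a rooted-signed-binary tree and $\overline{T}$ the rooted-signed-binary tree obtained from $T$ by reversing the sign of every non-root node. If $\sigma$ is the permutation produced by applying the insertion construction to $T$ with a fixed processing order, then applying the construction to $\overline{T}$ with the same processing order (on the correspondingly oppositely signed nodes) produces $\sigma^{ -1}$.
   Context: A rooted-signed-binary tree is a finite rooted binary tree (each node has at most one left and at most one right child) in which every non-root node has a sign $+$ or $-$; the root is unsigned. A tree with $m$ nodes has $m+1$ empty child slots, ordered left to right in symmetric (in-order) order. A non-root leaf $v$ of $T$ is in relative position $i$ if it occupies the $i$-th empty slot of $T-\{v\}$ ($T$ with $v$ deleted). Construction: let $\xi_m(k)=k$ for $k<m$ and $\xi_m(k)=k+1$ for $k\ge m$. For a permutation $s_1\cdots s_n$ and $1\le i\le n$, positive insertion at $i$ gives $\xi_{i+1}(s_1)\cdots \xi_{i+1}(s_{i-1})\,(i{+}1)\,\xi_{i+1}(s_{i})\cdots \xi_{i+1}(s_{n})$, negative insertion at $i$ gives $\xi_{i}(s_1)\cdots \xi_{i}(s_{i})\,(i)\,\xi_{i}(s_{i+1})\cdots \xi_{i}(s_{n})$. A processing order is a listing of the non-root nodes in which each node follows its non-root parent. Starting with $21$ for the root alone, process the nodes in order; when $v$ is processed, with relative position $i$ in the tree formed by the root, the nodes processed so far and $v$, apply the positive or negative insertion at $i$ according to the sign of $v$. The resulting permutation is the one produced. -}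

module Defs where

open import Data.Nat using (ℕ; zero; suc; _∸_; _<ᵇ_)
open import Data.Bool using (if_then_else_)
open import Data.List using (List; []; _∷_; _++_; _∷ʳ_; map; take; drop; length; upTo)
open import Data.List.Relation.Binary.Permutation.Propositional using (_↭_)
open import Data.List.Membership.Propositional using (_∈_)
open import Data.List.Properties using (≡-dec)
open import Data.Maybe using (Maybe; just; nothing)
open import Data.Product using (_×_; ∃; ∃-syntax)
open import Data.Sum using (_⊎_)
open import Data.Unit using (⊤)
open import Relation.Binary.PropositionalEquality using (_≡_; refl)
open import Relation.Binary.Definitions using (DecidableEquality)
open import Relation.Nullary using (yes; no)

data Sign : Set where
  plus minus : Sign

data SBT : Set where
  lf : SBT
  nd : Sign → SBT → SBT → SBT

-- a rooted-signed-binary tree: an unsigned root with a left and a right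
-- signed subtree (either possibly empty)
record RSBT : Set where
  constructor root
  field
    left  : SBT
    right : SBT
open RSBT public

flipSign : Sign → Sign
flipSign plus  = minus
flipSign minus = plus

flipS : SBT → SBT
flipS lf = lf
flipS (nd s l r) = nd (flipSign s) (flipS l) (flipS r)

flipT : RSBT → RSBT
flipT (root l r) = root (flipS l) (flipS r)

-- Addresses of nodes: paths from the root (root = [])

data Dir : Set where
  L R : Dir

_≟D_ : DecidableEquality Dir
L ≟D L = yes refl
L ≟D R = no λ ()
R ≟D L = no λ ()
R ≟D R = yes refl

Addr : Set
Addr = List Dir

_≟A_ : DecidableEquality Addr
_≟A_ = ≡-dec _≟D_

nodesS : SBT → List Addr
nodesS lf = []
nodesS (nd _ l r) = [] ∷ (map (L ∷_) (nodesS l) ++ map (R ∷_) (nodesS r))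

nonRootNodes : RSBT → List Addr
nonRootNodes (root l r) = map (L ∷_) (nodesS l) ++ map (R ∷_) (nodesS r)

signS : SBT → Addr → Maybe Sign
signS lf _ = nothing
signS (nd s _ _) [] = just s
signS (nd _ l _) (L ∷ a) = signS l a
signS (nd _ _ r) (R ∷ a) = signS r a

signAt : RSBT → Addr → Maybe Sign
signAt _ [] = nothing
signAt (root l _) (L ∷ a) = signS l a
signAt (root _ r) (R ∷ a) = signS r a

-- Processing orders: a listing of the non-root nodes in which each node
-- comes after its non-root parent.

ParentOK : List Addr → Addr → Set
ParentOK seen a = ∃[ p ] ∃[ d ] (a ≡ p ∷ʳ d × (p ≡ [] ⊎ p ∈ seen))

ParentsFirst : List Addr → List Addr → Set
ParentsFirst seen [] = ⊤
ParentsFirst seen (a ∷ rest) = ParentOK seen a × ParentsFirst (a ∷ seen) rest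

ProcessingOrder : RSBT → List Addr → Set
ProcessingOrder T ord = (ord ↭ nonRootNodes T) × ParentsFirst [] ord

-- Unsigned shapes of the partially built trees, their empty slots

data BT : Set where
  ε  : BT
  bn : BT → BT → BT

grow : BT → Addr → BT
grow ε [] = bn ε ε
grow ε (_ ∷ _) = ε
grow (bn l r) [] = bn l r
grow (bn l r) (L ∷ a) = bn (grow l a) r
grow (bn l r) (R ∷ a) = bn l (grow r a)

slots : BT → List Addr
slots ε = [] ∷ []
slots (bn l r) = map (L ∷_) (slots l) ++ map (R ∷_) (slots r)

-- 1-based position of the first occurrence (length+1 if absent)
position : {A : Set} → DecidableEquality A → A → List A → ℕ
position _≟_ x [] = 1
position _≟_ x (y ∷ ys) with x ≟ y
... | yes _ = 1
... | no  _ = suc (position _≟_ x ys)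

-- relative position of the leaf at address a, when the tree without it
-- has shape t
relPos : BT → Addr → ℕ
relPos t a = position _≟A_ a (slots t)

Perm : Set
Perm = List ℕ

ξ : ℕ → ℕ → ℕ
ξ m k = if k <ᵇ m then k else suc k

posIns : ℕ → Perm → Perm
posIns i s = take (i ∸ 1) s' ++ suc i ∷ drop (i ∸ 1) s'
  where s' = map (ξ (suc i)) s

negIns : ℕ → Perm → Perm
negIns i s = take i s' ++ i ∷ drop i s'
  where s' = map (ξ i) s

insertion : Maybe Sign → ℕ → Perm → Perm
insertion (just plus)  i s = posIns i s
insertion (just minus) i s = negIns i s
insertion nothing      i s = s   -- never used for processing orders

-- process the remaining nodes; t = shape of root + nodes processed so far
run : RSBT → BT → Perm → List Addr → Perm
run T t s [] = s
run T t s (a ∷ rest) = run T (grow t a) (insertion (signAt T a) (relPos t a) s) rest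

produce : RSBT → List Addr → Perm
produce T ord = run T (bn ε ε) (2 ∷ 1 ∷ []) ord

inverse : Perm → Perm
inverse s = map (λ j → position Data.Nat._≟_ j s) (map suc (upTo (length s)))

-- Inverting a permutation in one-line notation exchanges positions and values.
-- A positive insertion at i puts the value i+1 at position i and a negative one
-- puts the value i at position i+1, shifting the other entries and values
-- accordingly; so inversion turns the one into the other at the same i. By
-- induction along the processing order, the run on the flipped tree therefore
-- builds the inverses of the permutations built on T. This needs i to be in
-- range, which holds because every processed node fills an empty slot of the
-- tree built so far: its parent is already there and it is not.
module Submission where

open import Defs
open import Data.Nat as ℕ using (ℕ; zero; suc; _+_; _∸_; _<_; _≤_; _<ᵇ_; z≤n; s≤s; z<s)
open import Data.Nat.Properties using (<ᵇ-reflects-<; <⇒≱; <⇒≢; ≤-refl; ≤-trans; n≤1+n; <⇒≤; +-suc; suc-injective; _<?_; ≮⇒≥)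
open import Data.Bool using (true; false)
open import Data.List using (List; []; _∷_; _++_; _∷ʳ_; map; take; drop; length; upTo; applyUpTo)
open import Data.List.Properties using (∷-injectiveʳ; ++-identityʳ; length-map; length-++; map-∘; map-cong; map-upTo; map-applyUpTo)
open import Data.List.Membership.Propositional using (_∈_; _∉_)
open import Data.List.Membership.Propositional.Properties using (∈-map⁺; ∈-map⁻; ∈-++⁺ˡ; ∈-++⁺ʳ)
open import Data.List.Relation.Unary.Any using (here; there)
open import Data.List.Relation.Unary.All as All using (All; []; _∷_)
import Data.List.Relation.Unary.All.Properties as All
open import Data.List.Relation.Unary.AllPairs using ([]; _∷_)
open import Data.List.Relation.Unary.Unique.Propositional using (Unique)
import Data.List.Relation.Unary.Unique.Propositional.Properties as Unique
open import Data.List.Relation.Binary.Permutation.Propositional using (_↭_; ↭-sym; ↭⇒↭ₛ)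
open import Data.List.Relation.Binary.Permutation.Propositional.Properties using (All-resp-↭; shift)
import Data.List.Relation.Binary.Permutation.Setoid.Properties as PermutationSetoid
open import Data.Maybe as Maybe using (just; nothing)
open import Data.Product using (_×_; _,_; ∃)
open import Data.Sum as Sum using (_⊎_; inj₁; inj₂)
open import Function using (_∘_; _⇔_; mk⇔; Equivalence)
open import Relation.Binary.Definitions using (DecidableEquality)
open import Relation.Binary.PropositionalEquality
  using (_≡_; _≢_; refl; sym; trans; cong; cong₂; subst; setoid; module ≡-Reasoning)
open import Relation.Nullary using (¬_; yes; no; ofʸ; ofⁿ; contradiction)

insertAt : {A : Set} → ℕ → A → List A → List A
insertAt k y xs = take k xs ++ y ∷ drop k xs

length-insertAt : ∀ {A : Set} k (y : A) xs → length (insertAt k y xs) ≡ suc (length xs)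
length-insertAt zero    y xs       = refl
length-insertAt (suc k) y []       = refl
length-insertAt (suc k) y (x ∷ xs) = cong suc (length-insertAt k y xs)

ξ-< : ∀ {m k} → k < m → ξ m k ≡ k
ξ-< {m} {k} k<m with k <ᵇ m | <ᵇ-reflects-< k m
... | true  | _        = refl
... | false | ofⁿ k≮m = contradiction k<m k≮m

ξ-≥ : ∀ {m k} → m ≤ k → ξ m k ≡ suc k
ξ-≥ {m} {k} m≤k with k <ᵇ m | <ᵇ-reflects-< k m
... | true  | ofʸ k<m = contradiction m≤k (<⇒≱ k<m)
... | false | _        = refl

ξ-suc : ∀ m k → ξ (suc m) (suc k) ≡ suc (ξ m k)
ξ-suc m k with k <ᵇ m
... | true  = refl
... | false = refl

ξ-≢ : ∀ m k → ξ m k ≢ m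
ξ-≢ m k with k <? m
... | yes k<m = λ e → <⇒≢ k<m (trans (sym (ξ-< k<m)) e)
... | no  k≮m = λ e → <⇒≱ (subst (k <_) (trans (sym (ξ-≥ (≮⇒≥ k≮m))) e) ≤-refl) (≮⇒≥ k≮m)

ξ-<-≥ : ∀ {m j k} → j < m → m ≤ k → ξ m j < ξ m k
ξ-<-≥ {m} {j} {k} j<m m≤k rewrite ξ-< j<m | ξ-≥ m≤k = ≤-trans j<m (≤-trans m≤k (n≤1+n k))

ξ-injective : ∀ m {j k} → ξ m j ≡ ξ m k → j ≡ k
ξ-injective m {j} {k} e with j <? m | k <? m
... | yes j<m | yes k<m = trans (sym (ξ-< j<m)) (trans e (ξ-< k<m))
... | no  j≮m | no  k≮m = suc-injective (trans (sym (ξ-≥ (≮⇒≥ j≮m))) (trans e (ξ-≥ (≮⇒≥ k≮m))))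
... | yes j<m | no  k≮m = contradiction e (<⇒≢ (ξ-<-≥ j<m (≮⇒≥ k≮m)))
... | no  j≮m | yes k<m = contradiction (sym e) (<⇒≢ (ξ-<-≥ k<m (≮⇒≥ j≮m)))

module _ {A : Set} (_≟_ : DecidableEquality A) where

  1≤position : ∀ x xs → 1 ≤ position _≟_ x xs
  1≤position x []       = s≤s z≤n
  1≤position x (y ∷ ys) with x ≟ y
  ... | yes _ = s≤s z≤n
  ... | no  _ = s≤s z≤n

  position-≤-length : ∀ {x xs} → x ∈ xs → position _≟_ x xs ≤ length xs
  position-≤-length {x} {y ∷ ys} x∈ with x ≟ y | x∈
  ... | yes _   | _          = s≤s z≤n
  ... | no  x≢y | here x≡y   = contradiction x≡y x≢y
  ... | no  _   | there x∈ys = s≤s (position-≤-length x∈ys)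

  position-map : ∀ {f : A → A} → (∀ {x y} → f x ≡ f y → x ≡ y) →
                 ∀ x xs → position _≟_ (f x) (map f xs) ≡ position _≟_ x xs
  position-map f-inj x []       = refl
  position-map {f} f-inj x (y ∷ ys) with f x ≟ f y | x ≟ y
  ... | yes _     | yes _   = refl
  ... | no  _     | no  _   = cong suc (position-map f-inj x ys)
  ... | yes fx≡fy | no  x≢y = contradiction (f-inj fx≡fy) x≢y
  ... | no  fx≢fy | yes x≡y = contradiction (cong f x≡y) fx≢fy

  position-insertAt-self : ∀ {y} k xs → y ∉ xs → k ≤ length xs →
                           position _≟_ y (insertAt k y xs) ≡ suc k
  position-insertAt-self {y} zero xs _ _ with y ≟ y
  ... | yes _   = refl
  ... | no  y≢y = contradiction refl y≢y
  position-insertAt-self {y} (suc k) (x ∷ xs) y∉ (s≤s k≤n) with y ≟ x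
  ... | yes y≡x = contradiction (here y≡x) y∉
  ... | no  _   = cong suc (position-insertAt-self k xs (y∉ ∘ there) k≤n)

  position-insertAt-other : ∀ {x y} k xs → x ≢ y → k ≤ length xs →
                            position _≟_ x (insertAt k y xs) ≡ ξ (suc k) (position _≟_ x xs)
  position-insertAt-other {x} {y} zero xs x≢y _ with x ≟ y
  ... | yes x≡y = contradiction x≡y x≢y
  ... | no  _   = sym (ξ-≥ (1≤position x xs))
  position-insertAt-other {x} (suc k) (z ∷ zs) x≢y (s≤s k≤n) with x ≟ z
  ... | yes _ = refl
  ... | no  _ = trans (cong suc (position-insertAt-other k zs x≢y k≤n))
                      (sym (ξ-suc (suc k) (position _≟_ x zs)))

applyUpTo-insertAt : ∀ {A : Set} {f g : ℕ → A} {y} c n → c ≤ n →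
                     (∀ {j} → j < c → f j ≡ g j) → f c ≡ y → (∀ {j} → c ≤ j → f (suc j) ≡ g j) →
                     applyUpTo f (suc n) ≡ insertAt c y (applyUpTo g n)
applyUpTo-insertAt {f = f} {g} zero n _ _ fc≡y above = cong₂ _∷_ fc≡y (begin
  applyUpTo (f ∘ suc) n     ≡⟨ map-upTo (f ∘ suc) n ⟨
  map (f ∘ suc) (upTo n)    ≡⟨ map-cong (λ j → above z≤n) (upTo n) ⟩
  map g (upTo n)            ≡⟨ map-upTo g n ⟩
  applyUpTo g n             ∎)
  where open ≡-Reasoning
applyUpTo-insertAt (suc c) (suc n) (s≤s c≤n) below fc≡y above =
  cong₂ _∷_ (below z<s) (applyUpTo-insertAt c n c≤n (below ∘ s≤s) fc≡y (above ∘ s≤s))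

pos : ℕ → Perm → ℕ
pos = position ℕ._≟_

inverse-applyUpTo : ∀ s → inverse s ≡ applyUpTo (λ j → pos (suc j) s) (length s)
inverse-applyUpTo s = trans (sym (map-∘ (upTo (length s)))) (map-upTo _ (length s))

inverse-insertAt : ∀ k y s → k ≤ length s → y ≤ length s →
                   inverse (insertAt k (suc y) (map (ξ (suc y)) s))
                     ≡ insertAt y (suc k) (map (ξ (suc k)) (inverse s))
inverse-insertAt k y s k≤n y≤n = begin
  inverse P                                                    ≡⟨ inverse-applyUpTo P ⟩
  applyUpTo (λ j → pos (suc j) P) (length P)                   ≡⟨ cong (applyUpTo _) length-P ⟩
  applyUpTo (λ j → pos (suc j) P) (suc (length s))             ≡⟨ applyUpTo-insertAt y (length s) y≤n below new above ⟩
  insertAt y (suc k) (applyUpTo (ξ (suc k) ∘ λ j → pos (suc j) s) (length s))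
    ≡⟨ cong (insertAt y (suc k)) (map-applyUpTo _ (ξ (suc k)) (length s)) ⟨
  insertAt y (suc k) (map (ξ (suc k)) (applyUpTo (λ j → pos (suc j) s) (length s)))
    ≡⟨ cong (insertAt y (suc k) ∘ map (ξ (suc k))) (inverse-applyUpTo s) ⟨
  insertAt y (suc k) (map (ξ (suc k)) (inverse s))             ∎
  where
  open ≡-Reasoning
  s′ = map (ξ (suc y)) s
  P  = insertAt k (suc y) s′

  k≤n′ : k ≤ length s′
  k≤n′ = subst (k ≤_) (sym (length-map _ s)) k≤n

  length-P : length P ≡ suc (length s)
  length-P = trans (length-insertAt k (suc y) s′) (cong suc (length-map _ s))

  moved : ∀ v → pos (ξ (suc y) v) P ≡ ξ (suc k) (pos v s)
  moved v = trans (position-insertAt-other ℕ._≟_ k s′ (ξ-≢ (suc y) v) k≤n′)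
                  (cong (ξ (suc k)) (position-map ℕ._≟_ (ξ-injective (suc y)) v s))

  below : ∀ {j} → j < y → pos (suc j) P ≡ ξ (suc k) (pos (suc j) s)
  below {j} j<y = trans (cong (λ v → pos v P) (sym (ξ-< (s≤s j<y)))) (moved (suc j))

  above : ∀ {j} → y ≤ j → pos (suc (suc j)) P ≡ ξ (suc k) (pos (suc j) s)
  above {j} y≤j = trans (cong (λ v → pos v P) (sym (ξ-≥ (s≤s y≤j)))) (moved (suc j))

  new : pos (suc y) P ≡ suc k
  new = position-insertAt-self ℕ._≟_ k s′ fresh k≤n′
    where
    fresh : suc y ∉ s′
    fresh y∈ with ∈-map⁻ (ξ (suc y)) y∈
    ... | v , _ , y≡ξv = ξ-≢ (suc y) v (sym y≡ξv)

-- Definitionally, posIns i s = insertAt (i ∸ 1) (i + 1) (map (ξ (i + 1)) s)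
-- and negIns i s = insertAt i i (map (ξ i) s).
inverse-insertion : ∀ m {i} s → 1 ≤ i → i ≤ length s →
                    insertion (Maybe.map flipSign m) i (inverse s) ≡ inverse (insertion m i s)
inverse-insertion (just plus)  {suc j} s _ i≤n = sym (inverse-insertAt j (suc j) s (<⇒≤ i≤n) i≤n)
inverse-insertion (just minus) {suc j} s _ i≤n = sym (inverse-insertAt (suc j) j s i≤n (<⇒≤ i≤n))
inverse-insertion nothing              s _ _   = refl

data IsNode : BT → Addr → Set where
  top : ∀ {l r}   → IsNode (bn l r) []
  inL : ∀ {l r a} → IsNode l a → IsNode (bn l r) (L ∷ a)
  inR : ∀ {l r a} → IsNode r a → IsNode (bn l r) (R ∷ a)

data IsSlot : BT → Addr → Set where
  empty : IsSlot ε []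
  inL   : ∀ {l r a} → IsSlot l a → IsSlot (bn l r) (L ∷ a)
  inR   : ∀ {l r a} → IsSlot r a → IsSlot (bn l r) (R ∷ a)

IsSlot⇒∈slots : ∀ {t a} → IsSlot t a → a ∈ slots t
IsSlot⇒∈slots empty = here refl
IsSlot⇒∈slots (inL σ) = ∈-++⁺ˡ (∈-map⁺ (L ∷_) (IsSlot⇒∈slots σ))
IsSlot⇒∈slots {bn l _} (inR σ) = ∈-++⁺ʳ (map (L ∷_) (slots l)) (∈-map⁺ (R ∷_) (IsSlot⇒∈slots σ))

child-isSlot : ∀ {t} p d → IsNode t p → ¬ IsNode t (p ∷ʳ d) → IsSlot t (p ∷ʳ d)
child-isSlot {bn ε _}        [] L top _     = inL empty
child-isSlot {bn (bn _ _) _} [] L top ¬node = contradiction (inL top) ¬node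
child-isSlot {bn _ ε}        [] R top _     = inR empty
child-isSlot {bn _ (bn _ _)} [] R top ¬node = contradiction (inR top) ¬node
child-isSlot (L ∷ p) d (inL ν) ¬node = inL (child-isSlot p d ν (¬node ∘ inL))
child-isSlot (R ∷ p) d (inR ν) ¬node = inR (child-isSlot p d ν (¬node ∘ inR))

grow-isNode-new : ∀ {t a} → IsSlot t a → IsNode (grow t a) a
grow-isNode-new empty   = top
grow-isNode-new (inL σ) = inL (grow-isNode-new σ)
grow-isNode-new (inR σ) = inR (grow-isNode-new σ)

grow-isNode⁺ : ∀ {t a x} → IsSlot t a → IsNode t x → IsNode (grow t a) x
grow-isNode⁺ (inL σ) top     = top
grow-isNode⁺ (inL σ) (inL ν) = inL (grow-isNode⁺ σ ν)
grow-isNode⁺ (inL σ) (inR ν) = inR ν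
grow-isNode⁺ (inR σ) top     = top
grow-isNode⁺ (inR σ) (inL ν) = inL ν
grow-isNode⁺ (inR σ) (inR ν) = inR (grow-isNode⁺ σ ν)

grow-isNode⁻ : ∀ {t a x} → IsSlot t a → IsNode (grow t a) x → x ≡ a ⊎ IsNode t x
grow-isNode⁻ empty   top     = inj₁ refl
grow-isNode⁻ (inL σ) top     = inj₂ top
grow-isNode⁻ (inL σ) (inL ν) = Sum.map (cong (L ∷_)) inL (grow-isNode⁻ σ ν)
grow-isNode⁻ (inL σ) (inR ν) = inj₂ (inR ν)
grow-isNode⁻ (inR σ) top     = inj₂ top
grow-isNode⁻ (inR σ) (inL ν) = inj₂ (inL ν)
grow-isNode⁻ (inR σ) (inR ν) = Sum.map (cong (R ∷_)) inR (grow-isNode⁻ σ ν)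

length-slots : ∀ l r → length (slots (bn l r)) ≡ length (slots l) + length (slots r)
length-slots l r = trans (length-++ (map (L ∷_) (slots l)))
                         (cong₂ _+_ (length-map (L ∷_) (slots l)) (length-map (R ∷_) (slots r)))

length-slots-grow : ∀ {t a} → IsSlot t a → length (slots (grow t a)) ≡ suc (length (slots t))
length-slots-grow empty = refl
length-slots-grow {bn l r} (inL {a = a} σ) = begin
  length (slots (bn (grow l a) r))               ≡⟨ length-slots (grow l a) r ⟩
  length (slots (grow l a)) + length (slots r)   ≡⟨ cong (_+ length (slots r)) (length-slots-grow σ) ⟩
  suc (length (slots l) + length (slots r))      ≡⟨ cong suc (length-slots l r) ⟨
  suc (length (slots (bn l r)))                  ∎
  where open ≡-Reasoning
length-slots-grow {bn l r} (inR {a = a} σ) = begin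
  length (slots (bn l (grow r a)))               ≡⟨ length-slots l (grow r a) ⟩
  length (slots l) + length (slots (grow r a))   ≡⟨ cong (length (slots l) +_) (length-slots-grow σ) ⟩
  length (slots l) + suc (length (slots r))      ≡⟨ +-suc (length (slots l)) (length (slots r)) ⟩
  suc (length (slots l) + length (slots r))      ≡⟨ cong suc (length-slots l r) ⟨
  suc (length (slots (bn l r)))                  ∎
  where open ≡-Reasoning

NodesAre : BT → List Addr → Set
NodesAre t seen = ∀ x → IsNode t x ⇔ (x ≡ [] ⊎ x ∈ seen)

NodesAre-grow : ∀ {t a seen} → IsSlot t a → NodesAre t seen → NodesAre (grow t a) (a ∷ seen)
NodesAre-grow {t} {a} {seen} σ nodes x = mk⇔ to from
  where
  to : IsNode (grow t a) x → x ≡ [] ⊎ x ∈ a ∷ seen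
  to ν with grow-isNode⁻ σ ν
  ... | inj₁ x≡a = inj₂ (here x≡a)
  ... | inj₂ ν′  = Sum.map₂ there (Equivalence.to (nodes x) ν′)
  from : x ≡ [] ⊎ x ∈ a ∷ seen → IsNode (grow t a) x
  from (inj₂ (here refl)) = grow-isNode-new σ
  from (inj₂ (there x∈))  = grow-isNode⁺ σ (Equivalence.from (nodes x) (inj₂ x∈))
  from (inj₁ x≡[])        = grow-isNode⁺ σ (Equivalence.from (nodes x) (inj₁ x≡[]))

next-isSlot : ∀ {t seen a} → NodesAre t seen → ParentOK seen a → a ∉ seen → IsSlot t a
next-isSlot {t} nodes (p , d , refl , parent) a∉ =
  child-isSlot p d (Equivalence.from (nodes p) parent) ¬node
  where
  ∷ʳ-≢-[] : ∀ (q : Addr) → q ∷ʳ d ≢ []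
  ∷ʳ-≢-[] []      ()
  ∷ʳ-≢-[] (_ ∷ _) ()
  ¬node : ¬ IsNode t (p ∷ʳ d)
  ¬node ν with Equivalence.to (nodes (p ∷ʳ d)) ν
  ... | inj₁ a≡[] = ∷ʳ-≢-[] p a≡[]
  ... | inj₂ a∈   = a∉ a∈

signS-flipS : ∀ S a → signS (flipS S) a ≡ Maybe.map flipSign (signS S a)
signS-flipS lf         _       = refl
signS-flipS (nd _ _ _) []      = refl
signS-flipS (nd _ l _) (L ∷ a) = signS-flipS l a
signS-flipS (nd _ _ r) (R ∷ a) = signS-flipS r a

signAt-flipT : ∀ T a → signAt (flipT T) a ≡ Maybe.map flipSign (signAt T a)
signAt-flipT _          []      = refl
signAt-flipT (root l _) (L ∷ a) = signS-flipS l a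
signAt-flipT (root _ r) (R ∷ a) = signS-flipS r a

Signed : RSBT → Addr → Set
Signed T a = ∃ λ σ → signAt T a ≡ just σ

nodesS-signed : ∀ S → All (λ a → ∃ λ σ → signS S a ≡ just σ) (nodesS S)
nodesS-signed lf         = []
nodesS-signed (nd s l r) = (s , refl) ∷ All.++⁺ (All.map⁺ (nodesS-signed l)) (All.map⁺ (nodesS-signed r))

nonRootNodes-signed : ∀ T → All (Signed T) (nonRootNodes T)
nonRootNodes-signed (root l r) = All.++⁺ (All.map⁺ (nodesS-signed l)) (All.map⁺ (nodesS-signed r))

branches-unique : ∀ {xs ys : List Addr} → Unique xs → Unique ys →
                  Unique (map (L ∷_) xs ++ map (R ∷_) ys)
branches-unique uxs uys = Unique.++⁺ (Unique.map⁺ ∷-injectiveʳ uxs) (Unique.map⁺ ∷-injectiveʳ uys) disjoint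
  where
  disjoint : ∀ {v} → ¬ (v ∈ map (L ∷_) _ × v ∈ map (R ∷_) _)
  disjoint (v∈L , v∈R) with ∈-map⁻ (L ∷_) v∈L | ∈-map⁻ (R ∷_) v∈R
  ... | _ , _ , refl | _ , _ , ()

nodesS-unique : ∀ S → Unique (nodesS S)
nodesS-unique lf         = []
nodesS-unique (nd _ l r) =
  All.++⁺ (All.map⁺ (All.universal (λ _ ()) (nodesS l))) (All.map⁺ (All.universal (λ _ ()) (nodesS r)))
  ∷ branches-unique (nodesS-unique l) (nodesS-unique r)

nonRootNodes-unique : ∀ T → Unique (nonRootNodes T)
nonRootNodes-unique (root l r) = branches-unique (nodesS-unique l) (nodesS-unique r)

Unique-resp-↭ : ∀ {A : Set} {xs ys : List A} → xs ↭ ys → Unique xs → Unique ys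
Unique-resp-↭ {A} xs↭ys = PermutationSetoid.Unique-resp-↭ (setoid A) (↭⇒↭ₛ xs↭ys)

length-insertion : ∀ σ i s → length (insertion (just σ) i s) ≡ suc (length s)
length-insertion plus  i s = trans (length-insertAt (i ∸ 1) (suc i) _) (cong suc (length-map _ s))
length-insertion minus i s = trans (length-insertAt i i _) (cong suc (length-map _ s))

run-flipT : ∀ T t s seen ord →
            length s ≡ length (slots t) → NodesAre t seen → ParentsFirst seen ord →
            Unique (ord ++ seen) → All (Signed T) ord →
            run (flipT T) t (inverse s) ord ≡ inverse (run T t s ord)
run-flipT T t s seen [] _ _ _ _ _ = refl
run-flipT T t s seen (a ∷ ord) length-s nodes (parent , parents) (a∉ ∷ unique) ((σ , sign-a) ∷ signed) =
  begin
    run (flipT T) (grow t a) (insertion (signAt (flipT T) a) i (inverse s)) ord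
  ≡⟨ cong (λ s′ → run (flipT T) (grow t a) s′ ord) step ⟩
    run (flipT T) (grow t a) (inverse s₁) ord
  ≡⟨ run-flipT T (grow t a) s₁ (a ∷ seen) ord length-s₁ (NodesAre-grow slot nodes) parents unique′ signed ⟩
    inverse (run T (grow t a) s₁ ord)
  ∎
  where
  open ≡-Reasoning
  i  = relPos t a
  s₁ = insertion (signAt T a) i s

  slot : IsSlot t a
  slot = next-isSlot nodes parent (All.All¬⇒¬Any (All.++⁻ʳ ord a∉))

  i≤n : i ≤ length s
  i≤n = subst (i ≤_) (sym length-s) (position-≤-length _≟A_ (IsSlot⇒∈slots slot))

  step : insertion (signAt (flipT T) a) i (inverse s) ≡ inverse s₁
  step = trans (cong (λ m → insertion m i (inverse s)) (signAt-flipT T a))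
               (inverse-insertion (signAt T a) s (1≤position _≟A_ a (slots t)) i≤n)

  length-s₁ : length s₁ ≡ length (slots (grow t a))
  length-s₁ = begin
    length s₁                       ≡⟨ cong (λ m → length (insertion m i s)) sign-a ⟩
    length (insertion (just σ) i s) ≡⟨ length-insertion σ i s ⟩
    suc (length s)                  ≡⟨ cong suc length-s ⟩
    suc (length (slots t))          ≡⟨ length-slots-grow slot ⟨
    length (slots (grow t a))       ∎

  unique′ : Unique (ord ++ a ∷ seen)
  unique′ = Unique-resp-↭ (↭-sym (shift a ord seen)) (a∉ ∷ unique)

mainTheorem13 : (T : RSBT) (ord : List Addr) → ProcessingOrder T ord →
                  produce (flipT T) ord ≡ inverse (produce T ord)
mainTheorem13 T ord (ord↭nodes , parents) =
  run-flipT T (bn ε ε) (2 ∷ 1 ∷ []) [] ord refl initial parents unique signed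
  where
  initial : NodesAre (bn ε ε) []
  initial x = mk⇔ (λ { top → inj₁ refl }) (λ { (inj₁ refl) → top })

  unique : Unique (ord ++ [])
  unique = subst Unique (sym (++-identityʳ ord)) (Unique-resp-↭ (↭-sym ord↭nodes) (nonRootNodes-unique T))

  signed : All (Signed T) ord
  signed = All-resp-↭ (↭-sym ord↭nodes) (nonRootNodes-signed T)
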